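{- Let $\phi$ be the morphism on $\{0,1\}$ given by $\phi(0)=001$, $\phi(1)=1$, and let $\mathbf{x}=\phi^{\omega}(0)$. For every $k\ge0$, $\mathbf{x}$ has a prefix of the form $zz$ with $|z|=2^{k+1}-1$.
   Context: $\phi^{\omega}(0)$ denotes the infinite fixed point of $\phi$ beginning with $0$. -}

module Defs where

open import Data.Nat using (ℕ; zero; suc)
open import Data.List using (List; []; _∷_; concatMap; map)
open import Data.List.Base using (upTo)
open import Data.Fin using (Fin; zero; suc)

data Letter : Set where
  𝟎 𝟏 : Letter

φ : Letter → List Letter
φ 𝟎 = 𝟎 ∷ 𝟎 ∷ 𝟏 ∷ []
φ 𝟏 = 𝟏 ∷ []

φ* : List Letter → List Letter
φ* = concatMap φ

φIter : ℕ → List Letter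
φIter zero    = 𝟎 ∷ []
φIter (suc n) = φ* (φIter n)

nth : List Letter → ℕ → Letter
nth []       _       = 𝟎
nth (a ∷ w)  zero    = a
nth (a ∷ w)  (suc i) = nth w i

-- Since φ(0) begins with 0,
-- each φⁿ(0) is a prefix of φⁿ⁺¹(0), and |φⁿ(0)| = 2ⁿ⁺¹ - 1 ≥ n + 1,
-- so the i-th letter of the fixed point is the i-th letter of φ^(i+1)(0)
-- (always in range, hence the default in nth is never used).
x : ℕ → Letter
x i = nth (φIter (suc i)) i

prefix : (ℕ → Letter) → ℕ → List Letter
prefix w n = map w (upTo n)

module Submission where

-- Since φ fixes the letter 1, the iterates satisfy the recursion
--   φ^(n+1)(0) = φ^n(0) φ^n(0) 1,
-- so z = φ^k(0) gives the square zz as a prefix of φ^(k+1)(0), and the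
-- recursion |φ^(n+1)(0)| + 1 = 2 (|φ^n(0)| + 1) gives |z| = 2^(k+1) - 1.
-- It remains to see that every prefix of an iterate φ^n(0) is a prefix of
-- the fixed point x: the iterates form a prefix chain, and the letter x(i)
-- is read off φ^(i+1)(0), which is long enough to contain position i.

open import Defs
open import Data.Nat using (ℕ; zero; suc; _+_; _*_; _∸_; _^_; _<_; _≤′_; ≤′-reflexive; ≤′-step; s≤s; z≤n)
open import Data.Nat.Properties using (≤-total; ≤-trans; m≤n+m; +-identityʳ; +-suc; ≤⇒≤′; <-trans; n<1+n)
open import Data.List using (List; []; _∷_; length; _++_; map; concat; applyUpTo)
open import Data.List.Properties using (length-++; ++-assoc; map-++; concat-++; map-upTo; length-++-≤ˡ; ++-identityʳ)
open import Data.Product using (Σ; _×_; _,_)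
open import Data.Sum using (inj₁; inj₂)
open import Function using (_∘_)
open import Relation.Binary.PropositionalEquality using (_≡_; refl; sym; trans; cong; cong₂; subst; module ≡-Reasoning)
open ≡-Reasoning

φ*-++ : ∀ u v → φ* (u ++ v) ≡ φ* u ++ φ* v
φ*-++ u v = begin
  concat (map φ (u ++ v))             ≡⟨ cong concat (map-++ φ u v) ⟩
  concat (map φ u ++ map φ v)         ≡⟨ sym (concat-++ (map φ u) (map φ v)) ⟩
  concat (map φ u) ++ concat (map φ v) ∎

φIter-suc : ∀ n → φIter (suc n) ≡ φIter n ++ φIter n ++ 𝟏 ∷ []
φIter-suc zero    = refl
φIter-suc (suc n) = begin
  φ* (φIter (suc n))                                   ≡⟨ cong φ* (φIter-suc n) ⟩
  φ* (φIter n ++ φIter n ++ 𝟏 ∷ [])                    ≡⟨ φ*-++ (φIter n) _ ⟩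
  φIter (suc n) ++ φ* (φIter n ++ 𝟏 ∷ [])              ≡⟨ cong (φIter (suc n) ++_) (φ*-++ (φIter n) (𝟏 ∷ [])) ⟩
  φIter (suc n) ++ φIter (suc n) ++ 𝟏 ∷ []             ∎

length-φIter-suc : ∀ n →
  length (φIter (suc n)) ≡ length (φIter n) + suc (length (φIter n))
length-φIter-suc n = begin
  length (φIter (suc n))                            ≡⟨ cong length (φIter-suc n) ⟩
  length (φIter n ++ φIter n ++ 𝟏 ∷ [])             ≡⟨ length-++ (φIter n) ⟩
  length (φIter n) + length (φIter n ++ 𝟏 ∷ [])     ≡⟨ cong (length (φIter n) +_) (length-++ (φIter n)) ⟩
  length (φIter n) + (length (φIter n) + 1)         ≡⟨ cong (length (φIter n) +_) (+-suc (length (φIter n)) 0) ⟩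
  length (φIter n) + suc (length (φIter n) + 0)     ≡⟨ cong (λ m → length (φIter n) + suc m) (+-identityʳ _) ⟩
  length (φIter n) + suc (length (φIter n))         ∎

length-φIter : ∀ n → suc (length (φIter n)) ≡ 2 ^ suc n
length-φIter zero    = refl
length-φIter (suc n) = begin
  suc (length (φIter (suc n)))          ≡⟨ cong suc (length-φIter-suc n) ⟩
  suc ℓ + suc ℓ                         ≡⟨ cong₂ _+_ (length-φIter n) (trans (length-φIter n) (sym (+-identityʳ _))) ⟩
  2 ^ suc n + (2 ^ suc n + 0)           ∎
  where ℓ = length (φIter n)

n<length-φIter : ∀ n → n < length (φIter n)
n<length-φIter zero    = s≤s z≤n
n<length-φIter (suc n) = subst (suc n <_) (sym (length-φIter-suc n))
  (≤-trans (s≤s (n<length-φIter n)) (m≤n+m (suc (length (φIter n))) _))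

φIter-prefix : ∀ {n m} → n ≤′ m → Σ (List Letter) λ v → φIter m ≡ φIter n ++ v
φIter-prefix (≤′-reflexive refl) = [] , sym (++-identityʳ _)
φIter-prefix {n} (≤′-step {m} n≤′m) with φIter-prefix n≤′m
... | v , eq = v ++ φIter m ++ 𝟏 ∷ [] , (begin
  φIter (suc m)                          ≡⟨ φIter-suc m ⟩
  φIter m ++ φIter m ++ 𝟏 ∷ []           ≡⟨ cong (_++ φIter m ++ 𝟏 ∷ []) eq ⟩
  (φIter n ++ v) ++ φIter m ++ 𝟏 ∷ []    ≡⟨ ++-assoc (φIter n) v _ ⟩
  φIter n ++ v ++ φIter m ++ 𝟏 ∷ []      ∎)

nth-prefix : ∀ {w} u v i → w ≡ u ++ v → i < length u → nth w i ≡ nth u i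
nth-prefix (a ∷ u) v zero    refl _         = refl
nth-prefix (a ∷ u) v (suc i) refl (s≤s i<u) = nth-prefix u v i refl i<u

x-agrees-φIter : ∀ n i → i < length (φIter n) → x i ≡ nth (φIter n) i
x-agrees-φIter n i i<ℓn with ≤-total n (suc i)
... | inj₁ n≤i+1 with φIter-prefix (≤⇒≤′ n≤i+1)
...   | v , eq = nth-prefix (φIter n) v i eq i<ℓn
x-agrees-φIter n i i<ℓn | inj₂ i+1≤n with φIter-prefix (≤⇒≤′ i+1≤n)
...   | v , eq = sym (nth-prefix (φIter (suc i)) v i eq (<-trans (n<1+n i) (n<length-φIter (suc i))))

prefix-by-letters : ∀ f w → (∀ i → i < length w → f i ≡ nth w i) → prefix f (length w) ≡ w
prefix-by-letters f w agree = trans (map-upTo f (length w)) (applyUpTo-nth f w agree)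
  where
  applyUpTo-nth : ∀ f w → (∀ i → i < length w → f i ≡ nth w i) → applyUpTo f (length w) ≡ w
  applyUpTo-nth f []      agree = refl
  applyUpTo-nth f (a ∷ w) agree =
    cong₂ _∷_ (agree zero (s≤s z≤n)) (applyUpTo-nth (f ∘ suc) w (λ i i<w → agree (suc i) (s≤s i<w)))

prefix-of-φIter-is-prefix-of-x : ∀ n u v → φIter n ≡ u ++ v → prefix x (length u) ≡ u
prefix-of-φIter-is-prefix-of-x n u v eq = prefix-by-letters x u agree
  where
  agree : ∀ i → i < length u → x i ≡ nth u i
  agree i i<u = begin
    x i                 ≡⟨ x-agrees-φIter n i (subst (i <_) (cong length (sym eq)) (≤-trans i<u (length-++-≤ˡ u))) ⟩
    nth (φIter n) i     ≡⟨ nth-prefix u v i eq i<u ⟩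
    nth u i             ∎

mainTheorem17 : (k : ℕ) → Σ (List Letter) λ z →
    (length z ≡ 2 ^ suc k ∸ 1) × (prefix x (2 * length z) ≡ z ++ z)
mainTheorem17 k = z , cong (_∸ 1) (length-φIter k) , square-is-prefix
  where
  z : List Letter
  z = φIter k

  zz1 : φIter (suc k) ≡ (z ++ z) ++ 𝟏 ∷ []
  zz1 = trans (φIter-suc k) (sym (++-assoc z z (𝟏 ∷ [])))

  length-zz : 2 * length z ≡ length (z ++ z)
  length-zz = trans (cong (length z +_) (+-identityʳ (length z))) (sym (length-++ z))

  square-is-prefix : prefix x (2 * length z) ≡ z ++ z
  square-is-prefix = trans (cong (prefix x) length-zz)
    (prefix-of-φIter-is-prefix-of-x (suc k) (z ++ z) (𝟏 ∷ []) zz1)
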